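{- If $\mathsf{F}=(B,s,Y)$ is a finite object of $\mathbf{iE}$, then $B$ is finite.
   Context: $\Sigma$ is a set containing at least two distinct elements, denoted $0$ and $1$. A Chu space over $\Sigma$ is a triple $(A,r,X)$ with sets $A,X$ and a function $r:A\times X\to\Sigma$. A morphism $\varphi=(\varphi^+,\varphi^-):(A,r,X)\to(B,s,Y)$ consists of functions $\varphi^+:A\to B$, $\varphi^-:Y\to X$ with $s(\varphi^+(a),y)=r(a,\varphi^-(y))$ for all $a,y$; composition is $\varphi_2\circ\varphi_1=(\varphi_2^+\circ\varphi_1^+,\varphi_1^-\circ\varphi_2^-)$. $(A,r,X)$ is extensional if for $x,y\in X$, $r(-,x)=r(-,y)$ implies $x=y$. $\mathbf{E}$ is the category of extensional Chu spaces over $\Sigma$, and $\mathbf{iE}$ its subcategory with the same objects whose morphisms are the monomorphisms of $\mathbf{E}$. An $\omega$-sequence in $\mathbf{iE}$ is a family of objects $\mathsf{C}_i$ and $\mathbf{iE}$-morphisms $\varphi_i:\mathsf{C}_i\to\mathsf{C}_{i+1}$ ($i\ge1$); a cocone to $\mathsf{C}$ is a family of $\mathbf{iE}$-morphisms $\psi_i:\mathsf{C}_i\to\mathsf{C}$ with $\psi_{i+1}\circ\varphi_i=\psi_i$; it is a colimit in $\mathbf{iE}$ if for every cocone $(\psi'_i:\mathsf{C}_i\to\mathsf{C}')$ in $\mathbf{iE}$ there is a unique $\mathbf{iE}$-morphism $\psi:\mathsf{C}\to\mathsf{C}'$ with $\psi\circ\psi_i=\psi'_i$. An object $\mathsf{F}$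 of $\mathbf{iE}$ is a finite object of $\mathbf{iE}$ if for every $\omega$-sequence $(\mathsf{C}_i,\varphi_i)$ in $\mathbf{iE}$ having a colimit $(\psi_i:\mathsf{C}_i\to\mathsf{C})$ in $\mathbf{iE}$ and every $\mathbf{iE}$-morphism $\varphi:\mathsf{F}\to\mathsf{C}$, there exist $i\ge1$ and an $\mathbf{iE}$-morphism $\psi:\mathsf{F}\to\mathsf{C}_i$ with $\varphi=\psi_i\circ\psi$. -}

module Defs where

open import Level using (Level; 0ℓ) renaming (suc to lsuc)
open import Data.Nat using (ℕ; suc)
open import Data.Fin using (Fin)
open import Data.Product using (Σ; ∃; _×_; _,_)
open import Function.Bundles using (_↔_)
open import Relation.Binary.PropositionalEquality using (_≡_)

Finite : Set → Set
Finite B = ∃ λ n → B ↔ Fin n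

-- Chu spaces over a fixed alphabet S (the Σ of the paper).
module Chu (S : Set) where

  record ChuSpace : Set₁ where
    constructor chu
    field
      Pts  : Set
      Sts  : Set
      rel  : Pts → Sts → S

  open ChuSpace public

  record Hom (C D : ChuSpace) : Set where
    constructor hom
    field
      fwd : Pts C → Pts D
      bwd : Sts D → Sts C
      adj : ∀ a y → rel D (fwd a) y ≡ rel C a (bwd y)

  open Hom public

  _∘ₕ_ : {C D E : ChuSpace} → Hom D E → Hom C D → Hom C E
  _∘ₕ_ {C} {D} {E} g f = record
    { fwd = λ a → fwd g (fwd f a)
    ; bwd = λ z → bwd f (bwd g z)
    ; adj = λ a z → Eq.trans (adj g (fwd f a) z) (adj f a (bwd g z))
    }
    where import Relation.Binary.PropositionalEquality as Eq

  _≈ₕ_ : {C D : ChuSpace} → Hom C D → Hom C D → Set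
  f ≈ₕ g = (∀ a → fwd f a ≡ fwd g a) × (∀ y → bwd f y ≡ bwd g y)

  Extensional : ChuSpace → Set
  Extensional C = ∀ x y → (∀ a → rel C a x ≡ rel C a y) → x ≡ y

  record EObj : Set₁ where
    constructor eobj
    field
      space : ChuSpace
      ext   : Extensional space

  open EObj public

  IsMono : {C D : ChuSpace} → Hom C D → Set₁
  IsMono {C} {D} φ =
    (E : EObj) (f g : Hom (space E) C) → (φ ∘ₕ f) ≈ₕ (φ ∘ₕ g) → f ≈ₕ g

  record iHom (C D : EObj) : Set₁ where
    constructor ihom
    field
      mor  : Hom (space C) (space D)
      mono : IsMono mor

  open iHom public

  -- ω-sequences in iE (indexed from 1 in the paper; here from ℕ)
  record Seq : Set₁ where
    field
      obj  : ℕ → EObj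
      step : ∀ i → iHom (obj i) (obj (suc i))

  open Seq public

  record Cocone (σ : Seq) (C : EObj) : Set₁ where
    field
      leg  : ∀ i → iHom (obj σ i) C
      comm : ∀ i → (mor (leg (suc i)) ∘ₕ mor (step σ i)) ≈ₕ mor (leg i)

  open Cocone public

  IsColimit : (σ : Seq) (C : EObj) → Cocone σ C → Set₁
  IsColimit σ C κ =
    (C' : EObj) (κ' : Cocone σ C') →
      Σ (iHom C C') λ ψ →
        (∀ i → (mor ψ ∘ₕ mor (leg κ i)) ≈ₕ mor (leg κ' i)) ×
        ((ψ' : iHom C C') →
           (∀ i → (mor ψ' ∘ₕ mor (leg κ i)) ≈ₕ mor (leg κ' i)) →
           mor ψ' ≈ₕ mor ψ)

  IsFiniteObject : EObj → Set₁
  IsFiniteObject F =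
    (σ : Seq) (C : EObj) (κ : Cocone σ C) → IsColimit σ C κ →
    (φ : iHom F C) →
      Σ ℕ λ i → Σ (iHom F (obj σ i)) λ ψ →
        mor φ ≈ₕ (mor (leg κ i) ∘ₕ mor ψ)

-- Grade the points of F by any function r : B → ℕ and build the ω-chain whose i-th stage
-- keeps the points of grade ≤ i; the whole space is its colimit in iE.  The embedding of F
-- into that colimit factors through some stage i, so r is bounded by i.  If B were
-- infinite, excluded middle would give an injection f : ℕ → B and an r with r (f i) = i + 1,
-- which no stage can bound.
module Submission where

open import Defs
open import Level using (Level; 0ℓ)
open import Axiom.ExcludedMiddle using (ExcludedMiddle)
open import Relation.Binary.PropositionalEquality
  using (_≡_; _≢_; refl; sym; trans; cong; subst; module ≡-Reasoning)
open import Data.Nat using (ℕ; zero; suc; _≤_; _<_; _≤′_; ≤′-reflexive; ≤′-step; _⊔_; z≤n; s≤s)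
open import Data.Nat.Properties
  using (≤-refl; ≤-trans; ≤-irrelevant; n≤1+n; 1+n≰n; ≤⇒≤′; ≤′⇒≤; m≤m⊔n; m≤n⊔m; <-cmp)
open import Data.Fin using (Fin; zero; suc)
open import Data.Vec.Functional using (_∷_)
open import Data.Product using (Σ; ∃; _,_; proj₁; proj₂; map₂)
open import Data.Sum using (_⊎_; inj₁; inj₂; [_,_])
open import Data.Sum.Properties using (inj₁-injective)
open import Data.Unit using (⊤; tt)
open import Data.Empty using (⊥-elim)
open import Function using (id; const; _∘_)
open import Function.Bundles using (mk↔ₛ′)
open import Function.Definitions using (Injective)
open import Relation.Nullary using (Dec; yes; no; ¬_)
open import Relation.Nullary.Decidable using (decidable-stable)
open import Relation.Binary.Definitions using (tri<; tri≈; tri>)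

module _ (lem : ExcludedMiddle 0ℓ) {B : Set} where

  fresh-point : ¬ Finite B → ∀ {n} (f : Fin n → B) → Injective _≡_ _≡_ f →
                ∃ λ b → ∀ i → f i ≢ b
  fresh-point infinite {n} f f-inj = decidable-stable lem λ no-fresh →
    let hit : ∀ b → ∃ λ i → f i ≡ b
        hit b = decidable-stable lem λ miss → no-fresh (b , λ i fi≡b → miss (i , fi≡b))
    in infinite (n , mk↔ₛ′ (proj₁ ∘ hit) f (λ i → f-inj (proj₂ (hit (f i)))) (proj₂ ∘ hit))

  ∷-injective : ∀ {n b} {f : Fin n → B} → (∀ i → f i ≢ b) → Injective _≡_ _≡_ f →
                Injective _≡_ _≡_ (b ∷ f)
  ∷-injective b-fresh f-inj {zero} {zero} e = refl
  ∷-injective b-fresh f-inj {zero} {suc j} e = ⊥-elim (b-fresh j (sym e))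
  ∷-injective b-fresh f-inj {suc i} {zero} e = ⊥-elim (b-fresh i e)
  ∷-injective b-fresh f-inj {suc i} {suc j} e = cong suc (f-inj e)

  module Enumeration (infinite : ¬ Finite B) where

    -- prefix n lists seq (n - 1), …, seq 0, with seq n chosen outside prefix n.
    mutual
      prefix : ∀ n → Σ (Fin n → B) (Injective _≡_ _≡_)
      prefix zero    = (λ ()) , λ { {()} }
      prefix (suc n) = (seq n ∷ proj₁ (prefix n)) , ∷-injective (seq-fresh n) (proj₂ (prefix n))

      next : ∀ n → ∃ λ b → ∀ i → proj₁ (prefix n) i ≢ b
      next n = fresh-point infinite (proj₁ (prefix n)) (proj₂ (prefix n))

      seq : ℕ → B
      seq n = proj₁ (next n)

      seq-fresh : ∀ n i → proj₁ (prefix n) i ≢ seq n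
      seq-fresh n = proj₂ (next n)

    seq∈prefix : ∀ {m n} → m < n → ∃ λ i → proj₁ (prefix n) i ≡ seq m
    seq∈prefix {m} {suc n} (s≤s m≤n) with ≤⇒≤′ m≤n
    ... | ≤′-reflexive refl = zero , refl
    ... | ≤′-step m≤′n      = let i , p = seq∈prefix (s≤s (≤′⇒≤ m≤′n)) in suc i , p

    seq-injective : Injective _≡_ _≡_ seq
    seq-injective {m} {n} e with <-cmp m n
    ... | tri< m<n _ _ = let i , p = seq∈prefix m<n in ⊥-elim (seq-fresh n i (trans p e))
    ... | tri≈ _ m≡n _ = m≡n
    ... | tri> _ _ n<m = let i , p = seq∈prefix n<m in ⊥-elim (seq-fresh m i (trans p (sym e)))

  ¬Finite⇒injection : ¬ Finite B → ∃ λ (f : ℕ → B) → Injective _≡_ _≡_ f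
  ¬Finite⇒injection infinite = seq , seq-injective
    where open Enumeration infinite

  shifted-left-inverse : (f : ℕ → B) → Injective _≡_ _≡_ f →
                         ∃ λ (r : B → ℕ) → ∀ i → r (f i) ≡ suc i
  shifted-left-inverse f f-inj = (λ b → index (lem {∃ λ j → f j ≡ b})) , λ i → index-f i lem
    where
    index : ∀ {b} → Dec (∃ λ j → f j ≡ b) → ℕ
    index (yes (j , _)) = suc j
    index (no _)        = zero

    index-f : ∀ i (d : Dec (∃ λ j → f j ≡ f i)) → index d ≡ suc i
    index-f i (yes (j , fj≡fi)) = cong suc (f-inj fj≡fi)
    index-f i (no miss)         = ⊥-elim (miss (i , refl))

  bounded⇒finite : ((r : B → ℕ) → ∃ λ n → ∀ b → r b ≤ n) → Finite B
  bounded⇒finite bounded = decidable-stable lem λ infinite →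
    let f , f-inj = ¬Finite⇒injection infinite
        r , r∘f   = shifted-left-inverse f f-inj
        n , r≤n   = bounded r
    in 1+n≰n (subst (_≤ n) (r∘f n) (r≤n (f n)))

module _ (S : Set) where
  open Chu S

  injective⇒mono : {C D : ChuSpace} (φ : Hom C D) → Injective _≡_ _≡_ (fwd φ) → IsMono φ
  injective⇒mono {C} φ φ-inj E f g (fwd-eq , _) = fwd-≡ , bwd-≡
    where
    open ≡-Reasoning
    fwd-≡ : ∀ e → fwd f e ≡ fwd g e
    fwd-≡ e = φ-inj (fwd-eq e)
    bwd-≡ : ∀ x → bwd f x ≡ bwd g x
    bwd-≡ x = ext E _ _ λ e → begin
      rel (space E) e (bwd f x) ≡⟨ sym (adj f e x) ⟩
      rel C (fwd f e) x         ≡⟨ cong (λ c → rel C c x) (fwd-≡ e) ⟩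
      rel C (fwd g e) x         ≡⟨ adj g e x ⟩
      rel (space E) e (bwd g x) ∎

  -- Morphisms out of the one-point space with all of S as states are the points.
  generic-point : EObj
  generic-point = eobj (chu ⊤ S λ _ σ → σ) λ x y h → h tt

  mono⇒injective : {C D : ChuSpace} (φ : Hom C D) → IsMono φ → Injective _≡_ _≡_ (fwd φ)
  mono⇒injective {C} {D} φ φ-mono {a} {a'} e =
    proj₁ (φ-mono generic-point (point a) (point a') ((λ _ → e) , bwd-≡)) tt
    where
    open ≡-Reasoning
    point : Pts C → Hom (space generic-point) C
    point c = hom (const c) (rel C c) λ _ _ → refl
    bwd-≡ : ∀ y → rel C a (bwd φ y) ≡ rel C a' (bwd φ y)
    bwd-≡ y = begin
      rel C a (bwd φ y)  ≡⟨ sym (adj φ a y) ⟩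
      rel D (fwd φ a) y  ≡⟨ cong (λ d → rel D d y) e ⟩
      rel D (fwd φ a') y ≡⟨ adj φ a' y ⟩
      rel C a' (bwd φ y) ∎

  module Filtration (C : ChuSpace) (level : Pts C → ℕ)
    (separating : ∀ x y → (∀ a → level a ≡ 0 → rel C a x ≡ rel C a y) → x ≡ y) where

    Stage : ℕ → ChuSpace
    Stage i = chu (Σ (Pts C) λ a → level a ≤ i) (Sts C) (rel C ∘ proj₁)

    stage : ℕ → EObj
    stage i = eobj (Stage i) λ x y h → separating x y λ a a₀ → h (a , subst (_≤ i) (sym a₀) z≤n)

    whole : EObj
    whole = eobj C λ x y h → separating x y λ a _ → h a

    stage-≡ : ∀ {i} {p q : Pts (Stage i)} → proj₁ p ≡ proj₁ q → p ≡ q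
    stage-≡ {p = a , _} {q = .a , _} refl = cong (a ,_) (≤-irrelevant _ _)

    inclusion : ∀ {i j} → i ≤ j → iHom (stage i) (stage j)
    inclusion {i} {j} i≤j = ihom ι (injective⇒mono ι (stage-≡ ∘ cong proj₁))
      where
      ι : Hom (Stage i) (Stage j)
      ι = hom (map₂ (λ le → ≤-trans le i≤j)) id λ _ _ → refl

    embedding : ∀ i → iHom (stage i) whole
    embedding i = ihom ι (injective⇒mono ι stage-≡)
      where
      ι : Hom (Stage i) C
      ι = hom proj₁ id λ _ _ → refl

    chain : Seq
    chain = record { obj = stage ; step = λ i → inclusion (n≤1+n i) }

    cocone : Cocone chain whole
    cocone = record { leg = embedding ; comm = λ i → (λ _ → refl) , (λ _ → refl) }

    module Mediating (C' : EObj) (κ' : Cocone chain C') where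
      open ≡-Reasoning

      l : ∀ i → Hom (Stage i) (space C')
      l i = mor (leg κ' i)

      bwd-l : ∀ i z → bwd (l i) z ≡ bwd (l 0) z
      bwd-l zero    z = refl
      bwd-l (suc i) z = trans (proj₂ (comm κ' i) z) (bwd-l i z)

      fwd-l : ∀ {i j} → i ≤′ j → ∀ a (le : level a ≤ i) (le' : level a ≤ j) →
              fwd (l j) (a , le') ≡ fwd (l i) (a , le)
      fwd-l (≤′-reflexive refl) a le le' = cong (fwd (l _)) (stage-≡ refl)
      fwd-l (≤′-step {j} i≤j) a le le' = begin
        fwd (l (suc j)) (a , le')                         ≡⟨ cong (fwd (l (suc j))) (stage-≡ refl) ⟩
        fwd (l (suc j)) (a , ≤-trans le-j (n≤1+n j))      ≡⟨ proj₁ (comm κ' j) (a , le-j) ⟩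
        fwd (l j) (a , le-j)                              ≡⟨ fwd-l i≤j a le le-j ⟩
        fwd (l _) (a , le)                                ∎
        where
        le-j : level a ≤ j
        le-j = ≤-trans le (≤′⇒≤ i≤j)

      ψ : Hom C (space C')
      ψ = hom (λ a → fwd (l (level a)) (a , ≤-refl)) (bwd (l 0)) λ a z →
            trans (adj (l (level a)) (a , ≤-refl) z) (cong (rel C a) (bwd-l (level a) z))

      ψ-at : ∀ {j} a (le : level a ≤ j) → fwd ψ a ≡ fwd (l j) (a , le)
      ψ-at a le = sym (fwd-l (≤⇒≤′ le) a ≤-refl le)

      ψ-injective : Injective _≡_ _≡_ (fwd ψ)
      ψ-injective {a} {a'} e = cong proj₁ (mono⇒injective (l j) (mono (leg κ' j))
        (trans (sym (ψ-at a (m≤m⊔n _ _))) (trans e (ψ-at a' (m≤n⊔m _ _)))))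
        where
        j : ℕ
        j = level a ⊔ level a'

    colimit : IsColimit chain whole cocone
    colimit C' κ' =
      ihom ψ (injective⇒mono ψ ψ-injective) ,
      (λ i → (λ p → ψ-at (proj₁ p) (proj₂ p)) , (λ z → sym (bwd-l i z))) ,
      (λ ψ' ψ'-factors → (λ a → proj₁ (ψ'-factors (level a)) (a , ≤-refl)) , proj₂ (ψ'-factors 0))
      where open Mediating C' κ'

  finiteObject⇒bounded : (F : EObj) → IsFiniteObject F →
                         (r : Pts (space F) → ℕ) → ∃ λ n → ∀ b → r b ≤ n
  finiteObject⇒bounded F finite r = bound (finite chain whole cocone colimit embed)
    where
    B : Set
    B = Pts (space F)

    -- The second copy of B sits at level 0 and keeps every stage extensional.
    level : B ⊎ B → ℕ
    level = [ r , const 0 ]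

    open Filtration (chu (B ⊎ B) (Sts (space F)) [ rel (space F) , rel (space F) ]) level
      (λ x y h → ext F x y λ b → h (inj₂ b) refl)

    embed : iHom F whole
    embed = ihom ι (injective⇒mono ι inj₁-injective)
      where
      ι : Hom (space F) (space whole)
      ι = hom inj₁ id λ _ _ → refl

    bound : (Σ ℕ λ n → Σ (iHom F (stage n)) λ ψ → mor embed ≈ₕ (mor (embedding n) ∘ₕ mor ψ)) →
            ∃ λ n → ∀ b → r b ≤ n
    bound (n , ψ , factors , _) =
      n , λ b → subst (λ p → level p ≤ n) (sym (factors b)) (proj₂ (fwd (mor ψ) b))

theorem4p4 : (S : Set) (s0 s1 : S) → s0 ≢ s1 →
    (lem : ∀ {ℓ : Level} → ExcludedMiddle ℓ) →
    (F : Chu.EObj S) → Chu.IsFiniteObject S F →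
    Finite (Chu.ChuSpace.Pts (Chu.EObj.space F))
theorem4p4 S _ _ _ lem F finite = bounded⇒finite lem (finiteObject⇒bounded S F finite)
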